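{- Let $m$ be an odd positive integer and $k$ an even integer with $\sigma(m) = km$. Let $r$ be the number of distinct prime factors of $m$. If $r \geq 4$, then $\nu_2(k) < \frac{1}{3} r$.
   Context: $\sigma(m)$ denotes the sum of the positive divisors of $m$; $\nu_2(k)$ denotes the exponent of $2$ in the prime factorization of $k$. -}

module Defs where

open import Data.Nat using (ℕ; suc)
open import Data.Nat.Divisibility using (_∣?_)
open import Data.Nat.Primality using (prime?)
open import Data.List using (List; filter; upTo; length)
open import Data.Nat.ListAction using (sum)
open import Relation.Nullary.Decidable using (_×-dec_)

-- divisors of m: the d ∈ {0,…,m} with d ∣ m (0 never divides a positive m)
divisors : ℕ → List ℕ
divisors m = filter (λ d → d ∣? m) (upTo (suc m))

σ : ℕ → ℕ
σ m = sum (divisors m)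

ω : ℕ → ℕ
ω m = length (filter (λ p → prime? p ×-dec p ∣? m) (upTo (suc m)))

module Submission where

-- Idea.  List the prime factors of m increasingly as p₁ < ⋯ < p_r.  They are odd, so
-- pᵢ ≥ 2i + 1, and a prime power contributes σ(pᵃ)/pᵃ < p/(p-1) to the abundancy, whence
--   2ᵉ ≤ k = σ(m)/m ≤ ∏_{i<r} (2i+3)/(2i+2) = numer 2 r / denom 2 r.
-- Each factor ((l+1)/l)³ is at most 2 once l ≥ 4, and the first four factors give
-- (945/384)³ < 2⁴; hence (numer 2 r / denom 2 r)³ < 2^r for r ≥ 4, so 2^(3e) < 2^r.

module AbundancyBound where

  open import Defs
  open import Data.Nat.Base
    using ( ℕ; zero; suc; pred; _+_; _*_; _∸_; _^_; _≤_; _<_; s≤s; s≤s⁻¹; z<s; s<s; 2+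
          ; NonZero; NonTrivial; n>1⇒nonTrivial; nonTrivial⇒nonZero; ≢-nonZero; >-nonZero⁻¹)
  open import Data.Nat.Properties
  open import Data.Nat.Divisibility
  open import Data.Nat.Coprimality using (Coprime; coprime-divisor)
  open import Data.Nat.Primality
  open import Data.Nat.ListAction using (sum)
  open import Data.List.Base using (filter; applyUpTo; length)
  open import Data.Nat.Induction using (Acc; acc; <-wellFounded)
  open import Data.Product.Base using (Σ-syntax; _×_; _,_)
  open import Data.Sum.Base using (_⊎_; inj₁; inj₂)
  open import Function.Base using (_∘_; id)
  open import Relation.Nullary using (¬_; Dec; yes; no; contradiction)
  open import Relation.Nullary.Decidable using (_×-dec_; ¬?)
  open import Relation.Unary using (Decidable)
  open import Relation.Binary.PropositionalEquality
  open import Data.Nat.Tactic.RingSolver using (solve-∀)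
  open import Algebra.Properties.CommutativeSemigroup +-commutativeSemigroup
    using () renaming (interchange to +-interchange)
  open import Algebra.Properties.CommutativeSemigroup *-commutativeSemigroup
    using () renaming (interchange to *-interchange)

  indicator : ∀ {a} {A : Set a} → Dec A → ℕ → ℕ
  indicator (yes _) v = v
  indicator (no _)  _ = 0

  indicator-yes : ∀ {a} {A : Set a} (d : Dec A) {v} → A → indicator d v ≡ v
  indicator-yes (yes _) _ = refl
  indicator-yes (no ¬a) a = contradiction a ¬a

  indicator-no : ∀ {a} {A : Set a} (d : Dec A) {v} → ¬ A → indicator d v ≡ 0
  indicator-no (yes a) ¬a = contradiction a ¬a
  indicator-no (no _)  _  = refl

  indicator-⇔ : ∀ {a b} {A : Set a} {B : Set b} (d : Dec A) (e : Dec B) {v} →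
                (A → B) → (B → A) → indicator d v ≡ indicator e v
  indicator-⇔ (yes _) (yes _) _ _ = refl
  indicator-⇔ (no _)  (no _)  _ _ = refl
  indicator-⇔ (yes a) (no ¬b) f _ = contradiction (f a) ¬b
  indicator-⇔ (no ¬a) (yes b) _ g = contradiction (g b) ¬a

  indicator-split : ∀ {a} {A : Set a} (d : Dec A) v → v ≡ indicator d v + indicator (¬? d) v
  indicator-split (yes _) v = sym (+-identityʳ v)
  indicator-split (no _)  v = refl

  Σ< : ℕ → (ℕ → ℕ) → ℕ
  Σ< zero    g = 0
  Σ< (suc B) g = g 0 + Σ< B (g ∘ suc)

  Σ<-cong : ∀ B {g h} → (∀ i → i < B → g i ≡ h i) → Σ< B g ≡ Σ< B h
  Σ<-cong zero    _  = refl
  Σ<-cong (suc B) eq = cong₂ _+_ (eq 0 z<s) (Σ<-cong B (λ i i<B → eq (suc i) (s<s i<B)))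

  Σ<-zero : ∀ B {g} → (∀ i → i < B → g i ≡ 0) → Σ< B g ≡ 0
  Σ<-zero zero    _  = refl
  Σ<-zero (suc B) eq = cong₂ _+_ (eq 0 z<s) (Σ<-zero B (λ i i<B → eq (suc i) (s<s i<B)))

  Σ<-concat : ∀ a b g → Σ< (a + b) g ≡ Σ< a g + Σ< b (λ j → g (a + j))
  Σ<-concat zero    b g = refl
  Σ<-concat (suc a) b g = trans (cong (g 0 +_) (Σ<-concat a b (g ∘ suc))) (sym (+-assoc (g 0) _ _))

  Σ<-+ : ∀ B g h → Σ< B (λ i → g i + h i) ≡ Σ< B g + Σ< B h
  Σ<-+ zero    g h = refl
  Σ<-+ (suc B) g h =
    trans (cong (g 0 + h 0 +_) (Σ<-+ B (g ∘ suc) (h ∘ suc))) (+-interchange (g 0) (h 0) _ _)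

  Σ<-* : ∀ B c g → Σ< B (λ i → c * g i) ≡ c * Σ< B g
  Σ<-* zero    c g = sym (*-zeroʳ c)
  Σ<-* (suc B) c g = trans (cong (c * g 0 +_) (Σ<-* B c (g ∘ suc))) (sym (*-distribˡ-+ c (g 0) _))

  Σ<-split : ∀ B {P : ℕ → Set} (P? : Decidable P) g →
             Σ< B g ≡ Σ< B (λ x → indicator (P? x) (g x)) + Σ< B (λ x → indicator (¬? (P? x)) (g x))
  Σ<-split B P? g = trans (Σ<-cong B (λ x _ → indicator-split (P? x) (g x))) (Σ<-+ B _ _)

  Σ<-extend : ∀ {B B′} g → B ≤ B′ → (∀ i → B ≤ i → g i ≡ 0) → Σ< B′ g ≡ Σ< B g
  Σ<-extend {B} {B′} g B≤B′ vanish = begin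
    Σ< B′ g                                 ≡⟨ cong (λ C → Σ< C g) (m+[n∸m]≡n B≤B′) ⟨
    Σ< (B + (B′ ∸ B)) g                     ≡⟨ Σ<-concat B (B′ ∸ B) g ⟩
    Σ< B g + Σ< (B′ ∸ B) (λ j → g (B + j))  ≡⟨ cong (Σ< B g +_) tail≡0 ⟩
    Σ< B g + 0                              ≡⟨ +-identityʳ _ ⟩
    Σ< B g                                  ∎
    where
    open ≡-Reasoning
    tail≡0 : Σ< (B′ ∸ B) (λ j → g (B + j)) ≡ 0
    tail≡0 = Σ<-zero (B′ ∸ B) (λ j _ → vanish (B + j) (m≤m+n B j))

  Σ<-multiples : ∀ p .{{_ : NonZero p}} t h → (∀ x → p ∤ x → h x ≡ 0) →
                 Σ< (p * t) h ≡ Σ< t (λ y → h (p * y))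
  Σ<-multiples p zero h _ = cong (λ B → Σ< B h) (*-zeroʳ p)
  Σ<-multiples p@(suc q) (suc t) h vanish = begin
    Σ< (p * suc t) h                       ≡⟨ cong (λ B → Σ< B h) (*-suc p t) ⟩
    Σ< (p + p * t) h                       ≡⟨ Σ<-concat p (p * t) h ⟩
    Σ< p h + Σ< (p * t) (λ j → h (p + j))  ≡⟨ cong₂ _+_ first-block rest ⟩
    h 0 + Σ< t (λ y → h (p + p * y))       ≡⟨ cong₂ _+_ (cong h (*-zeroʳ p)) (Σ<-cong t (λ y _ → cong h (*-suc p y))) ⟨
    Σ< (suc t) (λ y → h (p * y))           ∎
    where
    open ≡-Reasoning
    -- the indices 1, …, p ∸ 1 of the first block are not multiples of p
    first-block : Σ< p h ≡ h 0
    first-block = trans (cong (h 0 +_) (Σ<-zero q (λ i i<q → vanish (suc i) (λ p∣i → <⇒≱ (s<s i<q) (∣⇒≤ p∣i)))))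
                        (+-identityʳ (h 0))
    rest : Σ< (p * t) (λ j → h (p + j)) ≡ Σ< t (λ y → h (p + p * y))
    rest = Σ<-multiples p t (λ j → h (p + j)) (λ x p∤x → vanish (p + x) (λ p∣p+x → p∤x (∣m+n∣m⇒∣n p∣p+x ∣-refl)))

  Σ<-point : ∀ p {B} → p < B → Σ< B (λ x → indicator (x ≟ p) 1) ≡ 1
  Σ<-point zero    {suc B} _         = cong suc (Σ<-zero B (λ _ _ → refl))
  Σ<-point (suc p) {suc B} (s<s p<B) =
    trans (Σ<-cong B (λ i _ → indicator-⇔ (suc i ≟ suc p) (i ≟ p) suc-injective (cong suc))) (Σ<-point p p<B)

  term≤Σ< : ∀ {B} g i → i < B → g i ≤ Σ< B g
  term≤Σ< {suc B} g zero    _         = m≤m+n (g 0) _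
  term≤Σ< {suc B} g (suc i) (s<s i<B) = ≤-trans (term≤Σ< (g ∘ suc) i i<B) (m≤n+m _ (g 0))

  sum-filter : ∀ {P : ℕ → Set} (P? : Decidable P) f B →
               sum (filter P? (applyUpTo f B)) ≡ Σ< B (λ i → indicator (P? (f i)) (f i))
  sum-filter P? f zero = refl
  sum-filter P? f (suc B) with P? (f 0)
  ... | yes _ = cong (f 0 +_) (sum-filter P? (f ∘ suc) B)
  ... | no  _ = sum-filter P? (f ∘ suc) B

  length-filter : ∀ {P : ℕ → Set} (P? : Decidable P) f B →
                  length (filter P? (applyUpTo f B)) ≡ Σ< B (λ i → indicator (P? (f i)) 1)
  length-filter P? f zero = refl
  length-filter P? f (suc B) with P? (f 0)
  ... | yes _ = cong suc (length-filter P? (f ∘ suc) B)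
  ... | no  _ = length-filter P? (f ∘ suc) B

  divisorTerm : ℕ → ℕ → ℕ
  divisorTerm M x = indicator (x ∣? M) x

  σ-as-sum : ∀ M .{{_ : NonZero M}} {B} → M < B → σ M ≡ Σ< B (divisorTerm M)
  σ-as-sum M M<B = trans (sum-filter (_∣? M) id (suc M)) (sym (Σ<-extend (divisorTerm M) M<B beyond))
    where
    beyond : ∀ x → suc M ≤ x → divisorTerm M x ≡ 0
    beyond x M<x = indicator-no (x ∣? M) (λ x∣M → <⇒≱ M<x (∣⇒≤ x∣M))

  m≤σ : ∀ M .{{_ : NonZero M}} → M ≤ σ M
  m≤σ M = begin
    M                             ≡⟨ indicator-yes (M ∣? M) ∣-refl ⟨
    divisorTerm M M               ≤⟨ term≤Σ< (divisorTerm M) M ≤-refl ⟩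
    Σ< (suc M) (divisorTerm M)    ≡⟨ σ-as-sum M ≤-refl ⟨
    σ M                           ∎
    where open ≤-Reasoning

  primeTerm : ℕ → ℕ → ℕ
  primeTerm M x = indicator (prime? x ×-dec x ∣? M) 1

  ω-as-sum : ∀ M .{{_ : NonZero M}} {B} → M < B → ω M ≡ Σ< B (primeTerm M)
  ω-as-sum M M<B = trans (length-filter (λ x → prime? x ×-dec x ∣? M) id (suc M))
                         (sym (Σ<-extend (primeTerm M) M<B beyond))
    where
    beyond : ∀ x → suc M ≤ x → primeTerm M x ≡ 0
    beyond x M<x = indicator-no (prime? x ×-dec x ∣? M) (λ (_ , x∣M) → <⇒≱ M<x (∣⇒≤ x∣M))

  ∤-prime⇒coprime : ∀ {p d} → Prime p → p ∤ d → Coprime d p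
  ∤-prime⇒coprime pr p∤d (c∣d , c∣p) with prime⇒irreducible pr c∣p
  ... | inj₁ c≡1 = c≡1
  ... | inj₂ refl = contradiction c∣d p∤d

  coprime-∣-power : ∀ {p d n} → Coprime d p → ∀ i → d ∣ p ^ i * n → d ∣ n
  coprime-∣-power {p} {d} {n} c zero    d∣n  = subst (d ∣_) (*-identityˡ n) d∣n
  coprime-∣-power {p} {d} {n} c (suc i) d∣pⁱn =
    coprime-∣-power c i (coprime-divisor c (subst (d ∣_) (*-assoc p (p ^ i) n) d∣pⁱn))

  prime-∣-power : ∀ {x p n} → Prime x → ∀ i → x ∣ p ^ i * n → x ∣ p ⊎ x ∣ n
  prime-∣-power {x} {p} {n} _  zero    x∣n   = inj₂ (subst (x ∣_) (*-identityˡ n) x∣n)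
  prime-∣-power {x} {p} {n} pr (suc i) x∣pⁱn
    with euclidsLemma p (p ^ i * n) pr (subst (x ∣_) (*-assoc p (p ^ i) n) x∣pⁱn)
  ... | inj₁ x∣p = inj₁ x∣p
  ... | inj₂ x∣rest = prime-∣-power pr i x∣rest

  -- The divisors of p M that are multiples of p are the p y with y ∣ M; they contribute p σ(M).
  σ-multiples : ∀ p .{{_ : NonZero p}} M .{{_ : NonZero M}} →
                Σ< (p * suc M) (λ x → indicator (p ∣? x) (divisorTerm (p * M) x)) ≡ p * σ M
  σ-multiples p M = begin
    Σ< (p * suc M) A                        ≡⟨ Σ<-multiples p (suc M) A (λ x p∤x → indicator-no (p ∣? x) p∤x) ⟩
    Σ< (suc M) (λ y → A (p * y))            ≡⟨ Σ<-cong (suc M) (λ y _ → A-scaled y) ⟩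
    Σ< (suc M) (λ y → p * divisorTerm M y)  ≡⟨ Σ<-* (suc M) p (divisorTerm M) ⟩
    p * Σ< (suc M) (divisorTerm M)          ≡⟨ cong (p *_) (σ-as-sum M ≤-refl) ⟨
    p * σ M                                 ∎
    where
    open ≡-Reasoning
    A : ℕ → ℕ
    A x = indicator (p ∣? x) (divisorTerm (p * M) x)
    A-scaled : ∀ y → A (p * y) ≡ p * divisorTerm M y
    A-scaled y rewrite indicator-yes (p ∣? p * y) {divisorTerm (p * M) (p * y)} (m∣m*n y) with y ∣? M
    ... | yes y∣M = indicator-yes (p * y ∣? p * M) (*-monoʳ-∣ p y∣M)
    ... | no  y∤M = trans (indicator-no (p * y ∣? p * M) (y∤M ∘ *-cancelˡ-∣ p)) (sym (*-zeroʳ p))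

  σ-coprime-part : ∀ {p n} → Prime p → p ∤ n → ∀ i x →
                   indicator (¬? (p ∣? x)) (divisorTerm (p ^ i * n) x) ≡ divisorTerm n x
  σ-coprime-part {p} {n} pr p∤n i x with p ∣? x
  ... | yes p∣x = sym (indicator-no (x ∣? n) (λ x∣n → p∤n (∣-trans p∣x x∣n)))
  ... | no  p∤x = indicator-⇔ (x ∣? p ^ i * n) (x ∣? n)
                    (coprime-∣-power (∤-prime⇒coprime pr p∤x) i) (∣n⇒∣m*n (p ^ i))

  σ-recursion : ∀ {p n} → Prime p → p ∤ n → .{{_ : NonZero n}} → ∀ a →
                σ (p ^ suc a * n) ≡ σ n + p * σ (p ^ a * n)
  σ-recursion {p} {n} pr p∤n a = begin
    σ N                         ≡⟨ σ-as-sum N N<B ⟩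
    Σ< B (divisorTerm N)        ≡⟨ Σ<-split B (p ∣?_) (divisorTerm N) ⟩
    Σ< B multiples + Σ< B rest  ≡⟨ cong₂ _+_ multiples≡ rest≡ ⟩
    p * σ M + σ n               ≡⟨ +-comm (p * σ M) (σ n) ⟩
    σ n + p * σ M               ∎
    where
    open ≡-Reasoning
    M = p ^ a * n
    N = p ^ suc a * n
    B = p * suc M
    instance
      p≢0 : NonZero p
      p≢0 = prime⇒nonZero pr
      M≢0 : NonZero M
      M≢0 = m*n≢0 (p ^ a) n {{m^n≢0 p a}}
      N≢0 : NonZero N
      N≢0 = m*n≢0 (p ^ suc a) n {{m^n≢0 p (suc a)}}
    N≡pM : N ≡ p * M
    N≡pM = *-assoc p (p ^ a) n
    N<B : N < B
    N<B = subst (_< B) (sym N≡pM) (*-monoʳ-< p (n<1+n M))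
    multiples rest : ℕ → ℕ
    multiples x = indicator (p ∣? x) (divisorTerm N x)
    rest x = indicator (¬? (p ∣? x)) (divisorTerm N x)
    multiples≡ : Σ< B multiples ≡ p * σ M
    multiples≡ = trans (cong (λ K → Σ< B (λ x → indicator (p ∣? x) (divisorTerm K x))) N≡pM) (σ-multiples p M)
    rest≡ : Σ< B rest ≡ σ n
    rest≡ = trans (Σ<-cong B (λ x _ → σ-coprime-part pr p∤n (suc a) x))
                  (sym (σ-as-sum n (≤-<-trans (∣⇒≤ (n∣m*n (p ^ suc a))) N<B)))

  ω-recursion : ∀ {p n} → Prime p → p ∤ n → .{{_ : NonZero n}} → ∀ a → ω (p ^ suc a * n) ≡ suc (ω n)
  ω-recursion {p} {n} pr p∤n a = begin
    ω N                                                 ≡⟨ ω-as-sum N ≤-refl ⟩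
    Σ< B (primeTerm N)                                  ≡⟨ Σ<-cong B (λ x _ → split x) ⟩
    Σ< B (λ x → primeTerm n x + indicator (x ≟ p) 1)    ≡⟨ Σ<-+ B (primeTerm n) (λ x → indicator (x ≟ p) 1) ⟩
    Σ< B (primeTerm n) + Σ< B (λ x → indicator (x ≟ p) 1) ≡⟨ cong₂ _+_ (ω-as-sum n (s≤s n≤N)) (sym (Σ<-point p (s≤s p≤N))) ⟨
    ω n + 1                                             ≡⟨ +-comm (ω n) 1 ⟩
    suc (ω n)                                           ∎
    where
    open ≡-Reasoning
    N = p ^ suc a * n
    B = suc N
    instance
      p≢0 : NonZero p
      p≢0 = prime⇒nonZero pr
      N≢0 : NonZero N
      N≢0 = m*n≢0 (p ^ suc a) n {{m^n≢0 p (suc a)}}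
    n≤N : n ≤ N
    n≤N = ∣⇒≤ (n∣m*n (p ^ suc a))
    p∣N : p ∣ N
    p∣N = ∣m⇒∣m*n n (∣m⇒∣m*n (p ^ a) ∣-refl)
    p≤N : p ≤ N
    p≤N = ∣⇒≤ p∣N
    split : ∀ x → primeTerm N x ≡ primeTerm n x + indicator (x ≟ p) 1
    split x with x ≟ p
    ... | yes refl = trans (indicator-yes (prime? x ×-dec x ∣? N) (pr , p∣N))
                           (cong (_+ 1) (sym (indicator-no (prime? x ×-dec x ∣? n) (λ (_ , p∣n) → p∤n p∣n))))
    ... | no x≢p = trans (indicator-⇔ (prime? x ×-dec x ∣? N) (prime? x ×-dec x ∣? n) to from)
                         (sym (+-identityʳ _))
      where
      to : Prime x × x ∣ N → Prime x × x ∣ n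
      to (px , x∣N) with prime-∣-power px (suc a) x∣N
      ... | inj₂ x∣n = px , x∣n
      ... | inj₁ x∣p with prime⇒irreducible pr x∣p
      ...   | inj₁ refl = contradiction px ¬prime[1]
      ...   | inj₂ x≡p  = contradiction x≡p x≢p
      from : Prime x × x ∣ n → Prime x × x ∣ N
      from (px , x∣n) = px , ∣n⇒∣m*n (p ^ suc a) x∣n

  -- (p-1) σ(pᵃ n) + σ(n) ≤ p^(a+1) σ(n) for a prime p ∤ n; in particular
  -- σ(pᵃ n)/(pᵃ n) < p/(p-1) · σ(n)/n.
  local-bound : ∀ {p n} → Prime p → p ∤ n → .{{_ : NonZero n}} → ∀ a →
                σ (p ^ a * n) * pred p + σ n ≤ p ^ suc a * σ n
  local-bound {zero}  (prime {{()}} _) _ _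
  local-bound {suc q} {n} _ _ zero rewrite *-identityˡ n = ≤-reflexive (base (σ n) q)
    where
    base : ∀ s q → s * q + s ≡ (1 + q) * 1 * s
    base = solve-∀
  local-bound {p@(suc q)} {n} pr p∤n (suc a) = begin
    σ (p ^ suc a * n) * q + σ n   ≡⟨ cong (λ s → s * q + σ n) (σ-recursion pr p∤n a) ⟩
    (σ n + p * X) * q + σ n       ≡⟨ regroup (σ n) q X ⟩
    p * (X * q + σ n)             ≤⟨ *-monoʳ-≤ p (local-bound pr p∤n a) ⟩
    p * (p ^ suc a * σ n)         ≡⟨ *-assoc p (p ^ suc a) (σ n) ⟨
    p ^ suc (suc a) * σ n         ∎
    where
    open ≤-Reasoning
    X = σ (p ^ a * n)
    regroup : ∀ s q X → (s + (1 + q) * X) * q + s ≡ (1 + q) * (X * q + s)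
    regroup = solve-∀

  -- If (p-1) X ≤ p P Y, Y D′ ≤ n N′ and l < p, then X · l D′ ≤ P n · (l+1) N′:
  -- a bound X/P ≤ p/(p-1) · Y combines with Y/n ≤ N′/D′ because p/(p-1) ≤ (l+1)/l.
  abundancy-step : ∀ {X Y p l P n D′ N′} → X * pred p ≤ p * P * Y → Y * D′ ≤ n * N′ → l < p →
                   X * (l * D′) ≤ (P * n) * (suc l * N′)
  abundancy-step {X} {Y} {p@(suc q)} {l} {P} {n} {D′} {N′} XY YD l<p = *-cancelˡ-≤ p (begin
    p * (X * (l * D′))          ≡⟨ e₁ p X l D′ ⟩
    (X * (l * p)) * D′          ≤⟨ *-monoˡ-≤ D′ (*-monoʳ-≤ X lp≤ql) ⟩
    (X * (q * suc l)) * D′      ≡⟨ e₂ X q l D′ ⟩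
    (X * q) * (suc l * D′)      ≤⟨ *-monoˡ-≤ (suc l * D′) XY ⟩
    (p * P * Y) * (suc l * D′)  ≡⟨ e₃ p P Y l D′ ⟩
    p * P * suc l * (Y * D′)    ≤⟨ *-monoʳ-≤ (p * P * suc l) YD ⟩
    p * P * suc l * (n * N′)    ≡⟨ e₄ p P l n N′ ⟩
    p * ((P * n) * (suc l * N′)) ∎)
    where
    open ≤-Reasoning
    lp≤ql : l * p ≤ q * suc l
    lp≤ql = begin
      l * suc q  ≡⟨ *-suc l q ⟩
      l + l * q  ≤⟨ +-monoˡ-≤ (l * q) (s≤s⁻¹ l<p) ⟩
      q + l * q  ≡⟨ cong (q +_) (*-comm l q) ⟩
      q + q * l  ≡⟨ *-suc q l ⟨
      q * suc l  ∎
    e₁ : ∀ p X l D → p * (X * (l * D)) ≡ (X * (l * p)) * D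
    e₁ = solve-∀
    e₂ : ∀ X q l D → (X * (q * (1 + l))) * D ≡ (X * q) * ((1 + l) * D)
    e₂ = solve-∀
    e₃ : ∀ p P Y l D → (p * P * Y) * ((1 + l) * D) ≡ p * P * (1 + l) * (Y * D)
    e₃ = solve-∀
    e₄ : ∀ p P l n N → p * P * (1 + l) * (n * N) ≡ p * ((P * n) * ((1 + l) * N))
    e₄ = solve-∀

  -- Searching upward from L for the least divisor p ≥ L of an L-rough m (t + L = m bounds the
  -- search); m is then p-rough.
  least-divisor : ∀ t {L m} → t + L ≡ m → L Rough m → Σ[ p ∈ ℕ ] (L ≤ p × p ∣ m × p Rough m)
  least-divisor zero    refl rough = _ , ≤-refl , ∣-refl , rough
  least-divisor (suc t) {L} {m} t+L≡m rough with L ∣? m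
  ... | yes L∣m = L , ≤-refl , L∣m , rough
  ... | no  L∤m with least-divisor t (trans (+-suc t L) t+L≡m) (∤⇒rough-suc L∤m rough)
  ...   | p , L<p , p∣m , p-rough = p , <⇒≤ L<p , p∣m , p-rough

  p-free-part : ∀ {p} → 2 ≤ p → ∀ m .{{_ : NonZero m}} → Acc _<_ m →
                Σ[ a ∈ ℕ ] Σ[ n ∈ ℕ ] (m ≡ p ^ a * n × p ∤ n)
  p-free-part {p} 2≤p m (acc smaller) with p ∣? m
  ... | no  p∤m = 0 , m , sym (*-identityˡ m) , p∤m
  ... | yes p∣m with p-free-part 2≤p (quotient p∣m) {{quotient≢0 p∣m}}
                       (smaller (quotient-< p∣m {{n>1⇒nonTrivial 2≤p}}))
  ...   | a , n , m/p≡pᵃn , p∤n = suc a , n , m≡pᵃ⁺¹n , p∤n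
    where
    open ≡-Reasoning
    m≡pᵃ⁺¹n : m ≡ p ^ suc a * n
    m≡pᵃ⁺¹n = begin
      m                ≡⟨ m∣n⇒n≡m*quotient p∣m ⟩
      p * quotient p∣m ≡⟨ cong (p *_) m/p≡pᵃn ⟩
      p * (p ^ a * n)  ≡⟨ *-assoc p (p ^ a) n ⟨
      p ^ suc a * n    ∎

  parity : ∀ n → 2 ∣ n ⊎ 2 ∣ suc n
  parity zero = inj₁ (2 ∣0)
  parity (suc n) with parity n
  ... | inj₁ 2∣n  = inj₂ (∣m∣n⇒∣m+n (divides 1 refl) 2∣n)
  ... | inj₂ 2∣1+n = inj₁ 2∣1+n

  -- An odd (p+1)-rough number is (p+2)-rough when p is odd, as p + 1 is then even.
  odd-rough-step : ∀ {p n} → 2 ∤ p → 2 ∤ n → suc p Rough n → (2 + p) Rough n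
  odd-rough-step {p} 2∤p 2∤n rough with parity p
  ... | inj₁ 2∣p   = contradiction 2∣p 2∤p
  ... | inj₂ 2∣1+p = ∤⇒rough-suc (λ 1+p∣n → 2∤n (∣-trans 2∣1+p 1+p∣n)) rough

  rough-mono : ∀ {a b n} → a ≤ b → b Rough n → a Rough n
  rough-mono a≤b rough nontrivial = rough (hasNonTrivialDivisor-≤ nontrivial a≤b)

  -- An (l+1)-rough m ≥ 2 with l ≥ 2 (so m is odd) is p^(a+1) n for its least prime factor
  -- p > l, with p ∤ n; since p and n are odd, n is (l+3)-rough.
  record Peeled (l m : ℕ) : Set where
    field
      p a n   : ℕ
      p-prime : Prime p
      l<p     : l < p
      m≡      : m ≡ p ^ suc a * n
      p∤n     : p ∤ n
      n≢0     : NonZero n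
      n-rough : (3 + l) Rough n

    ω-step : ω m ≡ suc (ω n)
    ω-step = trans (cong ω m≡) (ω-recursion p-prime p∤n {{n≢0}} a)

  peel : ∀ {l m} .{{_ : NonTrivial m}} → 2 ≤ l → suc l Rough m → Peeled l m
  peel {l} {m} 2≤l rough with least-divisor (m ∸ suc l) (m∸n+n≡m (rough⇒≤ rough)) rough
  ... | p , l<p , p∣m , p-rough
    with p-free-part (≤-trans (m≤n⇒m≤1+n 2≤l) l<p) m {{nonTrivial⇒nonZero m}} (<-wellFounded m)
  ... | zero  , n , m≡n   , p∤n = contradiction (subst (p ∣_) (trans m≡n (*-identityˡ n)) p∣m) p∤n
  ... | suc a , n , m≡pⁿ , p∤n = record
    { p = p ; a = a ; n = n ; p-prime = p-prime ; l<p = l<p ; m≡ = m≡pⁿ ; p∤n = p∤n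
    ; n≢0 = m*n≢0⇒n≢0 (p ^ suc a) {{subst NonZero m≡pⁿ (nonTrivial⇒nonZero m)}}
    ; n-rough = rough-mono (s≤s (s≤s l<p)) (odd-rough-step (odd p∣m) (odd n∣m) (∤⇒rough-suc p∤n (rough∧∣⇒rough p-rough n∣m)))
    }
    where
    instance
      p-nontrivial : NonTrivial p
      p-nontrivial = n>1⇒nonTrivial (≤-trans (m≤n⇒m≤1+n 2≤l) l<p)
    p-prime : Prime p
    p-prime = rough∧∣⇒prime p-rough p∣m
    n∣m : n ∣ m
    n∣m = subst (n ∣_) (sym m≡pⁿ) (n∣m*n (p ^ suc a))
    odd : ∀ {d} → d ∣ m → 2 ∤ d
    odd d∣m 2∣d = rough (hasNonTrivialDivisor (s≤s 2≤l) (∣-trans 2∣d d∣m))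

  -- numer l r / denom l r = ∏_{i<r} (l+2i+1)/(l+2i), an upper bound for σ(m)/m when m is
  -- (l+1)-rough and odd with r prime factors (see abundancy-bound).
  numer : ℕ → ℕ → ℕ
  numer l zero    = 1
  numer l (suc r) = suc l * numer (2 + l) r

  denom : ℕ → ℕ → ℕ
  denom l zero    = 1
  denom l (suc r) = l * denom (2 + l) r

  denom≢0 : ∀ l r .{{_ : NonZero l}} → NonZero (denom l r)
  denom≢0 l zero    = _
  denom≢0 l (suc r) = m*n≢0 l (denom (2 + l) r)
    where instance _ = denom≢0 (2 + l) r

  -- σ(m)/m ≤ numer l r / denom l r for (l+1)-rough m (l ≥ 2) with r distinct prime factors:
  -- the i-th prime factor is at least l + 2i + 1, and its power contributes at most p/(p-1).
  abundancy-bound : ∀ r l m .{{_ : NonZero m}} → 2 ≤ l → suc l Rough m → ω m ≡ r →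
                    σ m * denom l r ≤ m * numer l r
  abundancy-bound zero    l 1 _ _ _  = ≤-refl
  abundancy-bound (suc r) l 1 _ _ ()
  abundancy-bound zero    l m@(2+ _) 2≤l rough ωm≡0 = contradiction (trans (sym ωm≡0) ω-step) λ ()
    where open Peeled (peel 2≤l rough)
  abundancy-bound (suc r) l m@(2+ _) 2≤l rough ωm≡1+r = begin
    σ m * (l * denom (2 + l) r)                   ≡⟨ cong (λ k → σ k * (l * denom (2 + l) r)) m≡ ⟩
    σ (p ^ suc a * n) * (l * denom (2 + l) r)     ≤⟨ abundancy-step {X = σ (p ^ suc a * n)} {P = p ^ suc a} local ih l<p ⟩
    (p ^ suc a * n) * (suc l * numer (2 + l) r)   ≡⟨ cong (_* numer l (suc r)) m≡ ⟨
    m * numer l (suc r)                           ∎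
    where
    open ≤-Reasoning
    open Peeled (peel 2≤l rough)
    instance
      _ : NonZero n
      _ = n≢0
    ih : σ n * denom (2 + l) r ≤ n * numer (2 + l) r
    ih = abundancy-bound r (2 + l) n (≤-trans 2≤l (m≤n+m l 2)) n-rough
           (suc-injective (trans (sym ω-step) ωm≡1+r))
    local : σ (p ^ suc a * n) * pred p ≤ p * p ^ suc a * σ n
    local = ≤-trans (m≤m+n _ _) (local-bound p-prime p∤n (suc a))

  cube-* : ∀ a b → (a * b) ^ 3 ≡ a ^ 3 * b ^ 3
  cube-* = unfolded
    where
    unfolded : ∀ a b → (a * b) * ((a * b) * ((a * b) * 1)) ≡ (a * (a * (a * 1))) * (b * (b * (b * 1)))
    unfolded = solve-∀

  cube-ratio : ∀ t → (5 + t) ^ 3 ≤ 2 * (4 + t) ^ 3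
  cube-ratio t = subst ((5 + t) ^ 3 ≤_) (expand t) (m≤m+n _ _)
    where
    expand : ∀ t → (5 + t) * ((5 + t) * ((5 + t) * 1)) + (3 + 21 * t + 9 * (t * t) + t * (t * t))
                 ≡ 2 * ((4 + t) * ((4 + t) * ((4 + t) * 1)))
    expand = solve-∀

  tail-bound : ∀ t r → numer (4 + t) r ^ 3 ≤ 2 ^ r * denom (4 + t) r ^ 3
  tail-bound t zero    = ≤-refl
  tail-bound t (suc r) = begin
    ((5 + t) * N) ^ 3               ≡⟨ cube-* (5 + t) N ⟩
    (5 + t) ^ 3 * N ^ 3             ≤⟨ *-mono-≤ (cube-ratio t) (tail-bound (2 + t) r) ⟩
    (2 * l ^ 3) * (2 ^ r * D ^ 3)   ≡⟨ swap 2 (l ^ 3) (2 ^ r) (D ^ 3) ⟩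
    (2 * 2 ^ r) * (l ^ 3 * D ^ 3)   ≡⟨ cong (2 ^ suc r *_) (cube-* l D) ⟨
    2 ^ suc r * (l * D) ^ 3         ∎
    where
    open ≤-Reasoning
    l = 4 + t
    N = numer (2 + l) r
    D = denom (2 + l) r
    swap : ∀ a b c d → (a * b) * (c * d) ≡ (a * c) * (b * d)
    swap = solve-∀

  cube-ratio-* : ∀ a b x y k s .{{_ : NonZero y}} → a ^ 3 < 2 ^ k * b ^ 3 → x ^ 3 ≤ 2 ^ s * y ^ 3 →
                 (a * x) ^ 3 < 2 ^ (k + s) * (b * y) ^ 3
  cube-ratio-* a b x y k s a<b x≤y = begin-strict
    (a * x) ^ 3                       ≡⟨ cube-* a x ⟩
    a ^ 3 * x ^ 3                     ≤⟨ *-monoʳ-≤ (a ^ 3) x≤y ⟩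
    a ^ 3 * (2 ^ s * y ^ 3)           <⟨ *-monoˡ-< (2 ^ s * y ^ 3) a<b ⟩
    (2 ^ k * b ^ 3) * (2 ^ s * y ^ 3) ≡⟨ *-interchange (2 ^ k) (b ^ 3) (2 ^ s) (y ^ 3) ⟩
    (2 ^ k * 2 ^ s) * (b ^ 3 * y ^ 3) ≡⟨ cong₂ _*_ (^-distribˡ-+-* 2 k s) (cube-* b y) ⟨
    2 ^ (k + s) * (b * y) ^ 3         ∎
    where
    open ≤-Reasoning
    instance
      _ : NonZero (2 ^ s * y ^ 3)
      _ = m*n≢0 (2 ^ s) (y ^ 3) {{m^n≢0 2 s}} {{m^n≢0 y 3}}

  -- (945/384)³ < 2⁴ for the first four factors 3/2 · 5/4 · 7/6 · 9/8 of numer 2 r / denom 2 r.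
  head-bound : (3 * 5 * 7 * 9) ^ 3 < 2 ^ 4 * (2 * 4 * 6 * 8) ^ 3
  head-bound = <ᵇ⇒< ((3 * 5 * 7 * 9) ^ 3) (2 ^ 4 * (2 * 4 * 6 * 8) ^ 3) _

  cube-bound : ∀ r → 4 ≤ r → numer 2 r ^ 3 < 2 ^ r * denom 2 r ^ 3
  cube-bound 1 (s≤s ())
  cube-bound 2 (s≤s (s≤s ()))
  cube-bound 3 (s≤s (s≤s (s≤s ())))
  cube-bound (suc (suc (suc (suc s)))) _ =
    subst₂ (λ x y → x ^ 3 < 2 ^ (4 + s) * y ^ 3) (sym (regroup 3 5 7 9 N)) (sym (regroup 2 4 6 8 D))
      (cube-ratio-* (3 * 5 * 7 * 9) (2 * 4 * 6 * 8) N D 4 s {{denom≢0 10 s}} head-bound (tail-bound 6 s))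
    where
    N = numer 10 s
    D = denom 10 s
    regroup : ∀ a b c d x → a * (b * (c * (d * x))) ≡ (a * b * c * d) * x
    regroup = solve-∀

  odd⇒3-rough : ∀ {m} → 2 ∤ m → 3 Rough m
  odd⇒3-rough 2∤m (hasNonTrivialDivisor {divisor = 2} _ 2∣m) = 2∤m 2∣m
  odd⇒3-rough 2∤m (hasNonTrivialDivisor {divisor = suc (suc (suc _))} (s≤s (s≤s (s≤s ()))) _)

  odd-abundancy-2-adic : ∀ m .{{_ : NonZero m}} → 2 ∤ m → 4 ≤ ω m → ∀ K e →
                         σ m ≡ K * m → 2 ^ e ∣ K → 3 * e < ω m
  odd-abundancy-2-adic m 2∤m 4≤r K e σm≡Km 2ᵉ∣K = ≰⇒> λ r≤3e → <⇒≱ (cube-bound r 4≤r) (begin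
    2 ^ r * D ^ 3        ≤⟨ *-monoˡ-≤ (D ^ 3) (^-monoʳ-≤ 2 r≤3e) ⟩
    2 ^ (3 * e) * D ^ 3  ≡⟨ cong (λ k → 2 ^ k * D ^ 3) (*-comm 3 e) ⟩
    2 ^ (e * 3) * D ^ 3  ≡⟨ cong (_* D ^ 3) (^-*-assoc 2 e 3) ⟨
    (2 ^ e) ^ 3 * D ^ 3  ≡⟨ cube-* (2 ^ e) D ⟨
    (2 ^ e * D) ^ 3      ≤⟨ ^-monoˡ-≤ 3 2ᵉD≤N ⟩
    N ^ 3                ∎)
    where
    open ≤-Reasoning
    r = ω m
    N = numer 2 r
    D = denom 2 r
    instance
      -- K = 0 would give σ(m) = 0, but m ≤ σ(m)
      K≢0 : NonZero K
      K≢0 = ≢-nonZero λ K≡0 → <⇒≱ (>-nonZero⁻¹ m) (subst (m ≤_) (trans σm≡Km (cong (_* m) K≡0)) (m≤σ m))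
    KD≤N : K * D ≤ N
    KD≤N = *-cancelˡ-≤ m (begin
      m * (K * D)  ≡⟨ *-assoc m K D ⟨
      m * K * D    ≡⟨ cong (_* D) (trans (*-comm m K) (sym σm≡Km)) ⟩
      σ m * D      ≤⟨ abundancy-bound r 2 m ≤-refl (odd⇒3-rough 2∤m) refl ⟩
      m * N        ∎)
    2ᵉD≤N : 2 ^ e * D ≤ N
    2ᵉD≤N = ≤-trans (*-monoˡ-≤ D (∣⇒≤ 2ᵉ∣K)) KD≤N

open import Defs
open import Data.Nat using (ℕ; suc; _*_; _^_; _<_; _≥_; NonZero)
open import Data.Nat.Divisibility as ℕDiv using ()
open import Data.Integer using (ℤ; +_; ∣_∣)
open import Data.Integer.Divisibility using (_∣_)
open import Relation.Binary.PropositionalEquality using (_≡_; trans; cong)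
open import Relation.Nullary using (¬_)
open import Data.Integer.Properties using (abs-*)
open AbundancyBound using (odd-abundancy-2-adic)

-- Integer divisibility (+ 2ᵉ) ∣ k is divisibility 2ᵉ ∣ ∣k∣ of natural numbers, so the theorem is
-- the natural-number statement for K = ∣k∣.
lemma4 : (m : ℕ) → NonZero m → ¬ (2 ℕDiv.∣ m) → (k : ℤ) → (+ 2) ∣ k →
         + σ m ≡ k Data.Integer.* (+ m) → ω m ≥ 4 →
         (e : ℕ) → (+ (2 ^ e)) ∣ k → ¬ ((+ (2 ^ suc e)) ∣ k) →
         3 * e < ω m
lemma4 m m≢0 2∤m k _ σm≡km ω≥4 e 2ᵉ∣k _ =
  odd-abundancy-2-adic m {{m≢0}} 2∤m ω≥4 ∣ k ∣ e (trans (cong ∣_∣ σm≡km) (abs-* k (+ m))) 2ᵉ∣k
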